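{- For all positive integers $t,r$, $\operatorname{im}(K_t\times K_r)=(t-1)(r-1)+1$.
   Context: All graphs are finite and simple. A graph $G$ has a $G'$-immersion if there is an injective map $\phi:V(G')\to V(G)$ such that for every edge $uv\in E(G')$ there is a path in $G$ joining $\phi(u)$ and $\phi(v)$, and these paths are pairwise edge-disjoint. The immersion number $\operatorname{im}(G)$ is the largest $t$ such that $G$ has a $K_t$-immersion. The direct product $G\times H$ has vertex set $V(G)\times V(H)$, with $(g,h)$ adjacent to $(g',h')$ if and only if $gg'\in E(G)$ and $hh'\in E(H)$. $K_n$ denotes the complete graph on $n$ vertices. -}

module Defs where

open import Data.Nat using (ℕ; _≤_)
open import Data.Fin using (Fin; _<_)
open import Data.Product using (_×_; _,_; proj₁; proj₂)
open import Data.Sum using (_⊎_)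
open import Data.List using (List; []; _∷_)
open import Data.List.Membership.Propositional using (_∈_)
open import Data.List.Relation.Unary.Unique.Propositional using (Unique)
open import Relation.Binary.PropositionalEquality using (_≡_; _≢_)
open import Relation.Nullary using (¬_)
open import Function.Definitions using (Injective)

record Graph : Set₁ where
  field
    V     : Set
    Adj   : V → V → Set
    sym   : ∀ {x y} → Adj x y → Adj y x
    irrefl : ∀ {x} → ¬ Adj x x

open Graph public

K : ℕ → Graph
K n = record
  { V = Fin n
  ; Adj = λ i j → i ≢ j
  ; sym = λ i≢j j≡i → i≢j (Relation.Binary.PropositionalEquality.sym j≡i)
  ; irrefl = λ i≢i → i≢i Relation.Binary.PropositionalEquality.refl
  }

_×ᴳ_ : Graph → Graph → Graph
G ×ᴳ H = record
  { V = V G × V H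
  ; Adj = λ p q → Adj G (proj₁ p) (proj₁ q) × Adj H (proj₂ p) (proj₂ q)
  ; sym = λ a → sym G (proj₁ a) , sym H (proj₂ a)
  ; irrefl = λ a → irrefl G (proj₁ a)
  }

data Walk (G : Graph) : V G → V G → Set where
  [] : ∀ {x} → Walk G x x
  _∷_ : ∀ {x y z} → Adj G x y → Walk G y z → Walk G x z

vertices : ∀ {G x y} → Walk G x y → List (V G)
vertices {x = x} [] = x ∷ []
vertices {x = x} (_ ∷ w) = x ∷ vertices w

edges : ∀ {G x y} → Walk G x y → List (V G × V G)
edges [] = []
edges {x = x} (_∷_ {y = y} _ w) = (x , y) ∷ edges w

IsPath : ∀ {G x y} → Walk G x y → Set
IsPath w = Unique (vertices w)

SameEdge : ∀ {A : Set} → A × A → A × A → Set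
SameEdge (a , b) (c , d) = (a ≡ c × b ≡ d) ⊎ (a ≡ d × b ≡ c)

EdgeDisjoint : ∀ {G x y x' y'} → Walk G x y → Walk G x' y' → Set
EdgeDisjoint P Q = ∀ {e f} → e ∈ edges P → f ∈ edges Q → ¬ SameEdge e f

record Immersion (G : Graph) (m : ℕ) : Set where
  field
    φ      : Fin m → V G
    φ-inj  : Injective _≡_ _≡_ φ
    path   : (u v : Fin m) → u < v → Walk G (φ u) (φ v)
    isPath : ∀ u v (p : u < v) → IsPath (path u v p)
    disjoint : ∀ u v (p : u < v) u' v' (p' : u' < v') →
               ¬ (u ≡ u' × v ≡ v') → EdgeDisjoint (path u v p) (path u' v' p')

IsImmersionNumber : Graph → ℕ → Set
IsImmersionNumber G n = Immersion G n × (∀ m → Immersion G m → m ≤ n)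

module Submission where

-- Write t = n + 1 and r = m + 1.  Upper bound: in an immersion of K_{k+1} the k paths leaving one
-- branch vertex begin with distinct edges, and every vertex of K_{n+1} × K_{m+1} has degree n·m.
-- Lower bound: take as branch vertices the corner O = (0,0) and the n·m cells (i+1, j+1).  O is
-- adjacent to every cell, and so are two cells differing in both coordinates.  Two cells (i,j),
-- (i,j') of a common row are joined through the axis vertex C c = (0, c+1), where c is the
-- midpoint of j and j' in ℤ_M, M odd; columns symmetrically through R x = (x+1, 0).  When a
-- factor has even size k we take M = k + 1; the pairs whose midpoint is the missing point k are
-- rerouted over the edges that no midpoint uses ("spare" edges), with a detour through the other
-- axis when the other factor is odd.
-- Edge-disjointness is certified by an explicit owner function assigning to every edge the pair
-- of branch vertices allowed to use it.

open import Defs hiding (sym)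
open import Data.Nat using (ℕ; _≤_; _∸_; _*_; _+_)

-- Arithmetic modulo the odd number M = 2h + 1, in which 2 is invertible with inverse h + 1:
-- mid a b is the midpoint (a + b)/2 and unmid a c = 2c − a recovers b from a and mid a b.
module Halving (h : ℕ) where

  open import Data.Nat using (suc; _<_)
  open import Data.Nat.Properties using (+-assoc; +-comm; m+[n∸m]≡n; <⇒≤)
  open import Data.Nat.DivMod using (_%_; m%n<n; %-distribˡ-+; [m+kn]%n≡m%n; [m+n]%n≡m%n; m<n⇒m%n≡m)
  open import Data.Nat.Solver using (module +-*-Solver)
  open import Relation.Binary.PropositionalEquality
  open ≡-Reasoning
  open +-*-Solver

  M : ℕ
  M = suc (h + h)

  mid : ℕ → ℕ → ℕ
  mid a b = ((a + b) * suc h) % M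

  unmid : ℕ → ℕ → ℕ
  unmid a c = (c + c + (M ∸ a)) % M

  mid<M : ∀ a b → mid a b < M
  mid<M a b = m%n<n ((a + b) * suc h) M

  mid-comm : ∀ a b → mid a b ≡ mid b a
  mid-comm a b = cong (λ s → (s * suc h) % M) (+-comm a b)

  %-cong-+ʳ : ∀ {x y} z → x % M ≡ y % M → (x + z) % M ≡ (y + z) % M
  %-cong-+ʳ {x} {y} z e = begin
    (x + z) % M              ≡⟨ %-distribˡ-+ x z M ⟩
    (x % M + z % M) % M      ≡⟨ cong (λ u → (u + z % M) % M) e ⟩
    (y % M + z % M) % M      ≡⟨ %-distribˡ-+ y z M ⟨
    (y + z) % M              ∎

  -- 2 · mid a b ≡ a + b (mod M), because 2 (h + 1) = M + 1.
  double-mid : ∀ a b → (mid a b + mid a b) % M ≡ (a + b) % M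
  double-mid a b = begin
    (x % M + x % M) % M         ≡⟨ %-distribˡ-+ x x M ⟨
    (x + x) % M                 ≡⟨ cong (_% M) (twice-inverse (a + b)) ⟩
    (a + b + (a + b) * M) % M   ≡⟨ [m+kn]%n≡m%n (a + b) (a + b) M ⟩
    (a + b) % M                 ∎
    where
    x = (a + b) * suc h
    twice-inverse : ∀ s → s * suc h + s * suc h ≡ s + s * M
    twice-inverse s = solve 2
      (λ s k → s :* (con 1 :+ k) :+ s :* (con 1 :+ k) := s :+ s :* (con 1 :+ (k :+ k))) refl s h

  -- (a + b) − a ≡ b (mod M), computed without truncated subtraction going below zero.
  cancel-shift : ∀ a b → a < M → b < M → (a + b + (M ∸ a)) % M ≡ b
  cancel-shift a b a<M b<M = begin
    (a + b + (M ∸ a)) % M   ≡⟨ cong (_% M) rearrange ⟩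
    (b + M) % M             ≡⟨ [m+n]%n≡m%n b M ⟩
    b % M                   ≡⟨ m<n⇒m%n≡m b<M ⟩
    b                       ∎
    where
    rearrange : a + b + (M ∸ a) ≡ b + M
    rearrange = begin
      a + b + (M ∸ a)     ≡⟨ cong (_+ (M ∸ a)) (+-comm a b) ⟩
      b + a + (M ∸ a)     ≡⟨ +-assoc b a (M ∸ a) ⟩
      b + (a + (M ∸ a))   ≡⟨ cong (b +_) (m+[n∸m]≡n (<⇒≤ a<M)) ⟩
      b + M               ∎

  unmid-mid : ∀ {a b} → a < M → b < M → unmid a (mid a b) ≡ b
  unmid-mid {a} {b} a<M b<M = begin
    (mid a b + mid a b + (M ∸ a)) % M  ≡⟨ %-cong-+ʳ {mid a b + mid a b} {a + b} (M ∸ a) (double-mid a b) ⟩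
    (a + b + (M ∸ a)) % M              ≡⟨ cancel-shift a b a<M b<M ⟩
    b                                  ∎

  mid-fixed : ∀ {a b} → a < M → b < M → mid a b ≡ a → b ≡ a
  mid-fixed {a} {b} a<M b<M e = begin
    b                      ≡⟨ unmid-mid a<M b<M ⟨
    unmid a (mid a b)      ≡⟨ cong (unmid a) e ⟩
    unmid a a              ≡⟨ cancel-shift a a a<M a<M ⟩
    a                      ∎

module FinConversion where

  open import Data.Nat using (_<_; _<?_)
  open import Data.Nat.Properties using (≮⇒≥; <⇒≱)
  open import Data.Fin using (Fin; toℕ; fromℕ<)
  open import Data.Fin.Properties using (toℕ-fromℕ<; toℕ-injective; toℕ<n)
  open import Data.Maybe using (Maybe; just; nothing; fromMaybe)
  open import Data.Empty using (⊥-elim)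
  open import Relation.Nullary using (yes; no)
  open import Relation.Binary.PropositionalEquality

  toFin? : ∀ {k} → ℕ → Maybe (Fin k)
  toFin? {k} x with x <? k
  ... | yes x<k = just (fromℕ< x<k)
  ... | no _    = nothing

  toFin?-just : ∀ {k x} {a : Fin k} → toFin? x ≡ just a → toℕ a ≡ x
  toFin?-just {k} {x} e with x <? k
  toFin?-just refl | yes x<k = toℕ-fromℕ< x<k

  toFin?-nothing : ∀ {k x} → toFin? {k} x ≡ nothing → k ≤ x
  toFin?-nothing {k} {x} e with x <? k
  toFin?-nothing () | yes _
  ... | no x≮k = ≮⇒≥ x≮k

  toFin?-≥ : ∀ {k x} → k ≤ x → toFin? {k} x ≡ nothing
  toFin?-≥ {k} {x} k≤x with x <? k
  ... | yes x<k = ⊥-elim (<⇒≱ x<k k≤x)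
  ... | no _    = refl

  toFin?-toℕ : ∀ {k x} {a : Fin k} → x ≡ toℕ a → toFin? x ≡ just a
  toFin?-toℕ {k} {x} {a} e with x <? k
  ... | yes x<k = cong just (toℕ-injective (trans (toℕ-fromℕ< x<k) e))
  ... | no x≮k  = ⊥-elim (x≮k (subst (_< k) (sym e) (toℕ<n a)))

  toFinOr : ∀ {k} → ℕ → Fin k → Fin k
  toFinOr x d = fromMaybe d (toFin? x)

  toFinOr-toℕ : ∀ {k x} {a d : Fin k} → x ≡ toℕ a → toFinOr x d ≡ a
  toFinOr-toℕ {d = d} e = cong (fromMaybe d) (toFin?-toℕ e)

  toℕ-toFinOr : ∀ {k x} {d : Fin k} → x < k → toℕ (toFinOr x d) ≡ x
  toℕ-toFinOr x<k = trans (cong toℕ (toFinOr-toℕ (sym (toℕ-fromℕ< x<k)))) (toℕ-fromℕ< x<k)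

-- Midpoint schemes on K_k: the combinatorial data, extracted from halving modulo an odd number,
-- that drives the routing of pairs inside one row (or column) of the product.
module MidpointSchemes where

  open import Data.Nat using (zero; suc; _<_; parity; ⌊_/2⌋)
  open import Data.Nat.Properties
    using (≤-antisym; <⇒≤pred; <-irrefl; ≤∧≢⇒<; +-suc; ≤-refl; n≤1+n; ≤-trans; <-≤-trans; ≤-reflexive)
  open import Data.Parity.Base using (0ℙ; 1ℙ)
  open import Data.Fin using (Fin; toℕ)
  open import Data.Fin.Properties using (toℕ<n; toℕ-injective)
  open import Data.Maybe using (Maybe; just; nothing)
  open import Data.Product using (_×_; _,_; proj₂)
  open import Data.Sum using (_⊎_; inj₁; inj₂; [_,_]′)
  open import Data.Empty using (⊥-elim)
  open import Relation.Binary.PropositionalEquality using (_≡_; _≢_; refl; sym; trans; cong)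
  open Relation.Binary.PropositionalEquality.≡-Reasoning
  open FinConversion

  0ℙ≢1ℙ : 0ℙ ≢ 1ℙ
  0ℙ≢1ℙ ()

  -- mid a b is a point distinct from a and b (for a ≠ b), and a is recovered from mid a b
  -- and b by partner, so the edges {a, mid a b} are pairwise distinct for fixed a.  The
  -- "broken" pairs with no midpoint exist only for even k; there each a has exactly one broken
  -- partner, its mate, and one spare point that is the midpoint of a with nothing; spare is a
  -- bijection with inverse spare⁻¹.
  record Midpoints (k : ℕ) : Set where
    field
      mid           : Fin k → Fin k → Maybe (Fin k)
      mid-comm      : ∀ a b → mid a b ≡ mid b a
      mid-ne        : ∀ {a b c} → a ≢ b → mid a b ≡ just c → c ≢ a
      partner       : Fin k → Fin k → Maybe (Fin k)
      partner-mid   : ∀ {a b c} → mid a b ≡ just c → partner a c ≡ just b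
      mate          : Fin k → Fin k
      mate-mid      : ∀ {a b} → mid a b ≡ nothing → mate a ≡ b
      odd-complete  : parity k ≡ 1ℙ → ∀ {a b} → mid a b ≢ nothing
      spare         : Fin k → Fin k
      spare⁻¹       : Fin k → Fin k
      spare-ne      : parity k ≡ 0ℙ → ∀ a → spare a ≢ a
      partner-spare : parity k ≡ 0ℙ → ∀ a → partner a (spare a) ≡ nothing
      spare⁻¹-spare : parity k ≡ 0ℙ → ∀ a → spare⁻¹ (spare a) ≡ a

  module MidpointProperties {k : ℕ} (S : Midpoints k) where
    open Midpoints S

    broken⇒even : ∀ {a b} → mid a b ≡ nothing → parity k ≡ 0ℙ
    broken⇒even {a} {b} e with parity k in p
    ... | 0ℙ = refl
    ... | 1ℙ = ⊥-elim (odd-complete p e)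

    mid-ne′ : ∀ {a b c} → a ≢ b → mid a b ≡ just c → c ≢ b
    mid-ne′ {a} {b} a≢b e = mid-ne (λ b≡a → a≢b (sym b≡a)) (trans (mid-comm b a) e)

    spare-injective : parity k ≡ 0ℙ → ∀ {a b} → spare a ≡ spare b → a ≡ b
    spare-injective ev {a} {b} e =
      trans (sym (spare⁻¹-spare ev a)) (trans (cong spare⁻¹ e) (spare⁻¹-spare ev b))

  module FromHalving (h k : ℕ)
    (shape : (parity k ≡ 1ℙ × k ≡ suc (h + h)) ⊎ (parity k ≡ 0ℙ × suc k ≡ suc (h + h))) where

    open Halving h renaming (mid to midℕ; mid-comm to midℕ-comm)

    odd-k : parity k ≡ 1ℙ → k ≡ M
    odd-k o = [ proj₂ , (λ (e , _) → ⊥-elim (0ℙ≢1ℙ (trans (sym e) o))) ]′ shape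

    even-k : parity k ≡ 0ℙ → suc k ≡ M
    even-k ev = [ (λ (o , _) → ⊥-elim (0ℙ≢1ℙ (trans (sym ev) o))) , proj₂ ]′ shape

    k≤M : k ≤ M
    k≤M = [ (λ (_ , k≡M) → ≤-reflexive k≡M)
          , (λ (_ , 1+k≡M) → ≤-trans (n≤1+n k) (≤-reflexive 1+k≡M)) ]′ shape

    M≤1+k : M ≤ suc k
    M≤1+k = [ (λ (_ , k≡M) → ≤-trans (≤-reflexive (sym k≡M)) (n≤1+n k))
            , (λ (_ , 1+k≡M) → ≤-reflexive (sym 1+k≡M)) ]′ shape

    <M : (a : Fin k) → toℕ a < M
    <M a = <-≤-trans (toℕ<n a) k≤M

    -- Midpoints are taken in ℤ_M; one that falls on the missing point k (k even) is broken.
    mid : Fin k → Fin k → Maybe (Fin k)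
    mid a b = toFin? (midℕ (toℕ a) (toℕ b))

    partner : Fin k → Fin k → Maybe (Fin k)
    partner a c = toFin? (unmid (toℕ a) (toℕ c))

    -- mate a = 2k − a, spare a = (a + k)/2 and spare⁻¹ c = 2c − k in ℤ_M (defaults never used).
    mate : Fin k → Fin k
    mate a = toFinOr (unmid (toℕ a) k) a

    spare : Fin k → Fin k
    spare a = toFinOr (midℕ (toℕ a) k) a

    spare⁻¹ : Fin k → Fin k
    spare⁻¹ c = toFinOr (unmid k (toℕ c)) c

    mid-comm : ∀ a b → mid a b ≡ mid b a
    mid-comm a b = cong toFin? (midℕ-comm (toℕ a) (toℕ b))

    mid-just : ∀ {a b c} → mid a b ≡ just c → toℕ c ≡ midℕ (toℕ a) (toℕ b)
    mid-just {a} {b} = toFin?-just {x = midℕ (toℕ a) (toℕ b)}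

    mid-nothing : ∀ {a b} → mid a b ≡ nothing → midℕ (toℕ a) (toℕ b) ≡ k
    mid-nothing {a} {b} e = ≤-antisym (<⇒≤pred (<-≤-trans (mid<M (toℕ a) (toℕ b)) M≤1+k))
                                      (toFin?-nothing {k} {midℕ (toℕ a) (toℕ b)} e)

    mid-ne : ∀ {a b c} → a ≢ b → mid a b ≡ just c → c ≢ a
    mid-ne {a} {b} a≢b e refl =
      a≢b (sym (toℕ-injective (mid-fixed (<M a) (<M b) (sym (mid-just {a} {b} e)))))

    partner-mid : ∀ {a b c} → mid a b ≡ just c → partner a c ≡ just b
    partner-mid {a} {b} e =
      toFin?-toℕ (trans (cong (unmid (toℕ a)) (mid-just {a} {b} e)) (unmid-mid (<M a) (<M b)))

    mate-mid : ∀ {a b} → mid a b ≡ nothing → mate a ≡ b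
    mate-mid {a} {b} e =
      toFinOr-toℕ (trans (cong (unmid (toℕ a)) (sym (mid-nothing {a} {b} e))) (unmid-mid (<M a) (<M b)))

    odd-complete : parity k ≡ 1ℙ → ∀ {a b} → mid a b ≢ nothing
    odd-complete o {a} {b} e =
      <-irrefl (trans (mid-nothing {a} {b} e) (odd-k o)) (mid<M (toℕ a) (toℕ b))

    k<M : parity k ≡ 0ℙ → k < M
    k<M ev = ≤-reflexive (even-k ev)

    spare-value : parity k ≡ 0ℙ → ∀ a → midℕ (toℕ a) k < k
    spare-value ev a = ≤∧≢⇒< (<⇒≤pred (<-≤-trans (mid<M (toℕ a) k) M≤1+k)) mid≢k
      where
      mid≢k : midℕ (toℕ a) k ≢ k
      mid≢k e = <-irrefl (mid-fixed (k<M ev) (<M a) (trans (midℕ-comm k (toℕ a)) e)) (toℕ<n a)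

    toℕ-spare : parity k ≡ 0ℙ → ∀ a → toℕ (spare a) ≡ midℕ (toℕ a) k
    toℕ-spare ev a = toℕ-toFinOr (spare-value ev a)

    spare-ne : parity k ≡ 0ℙ → ∀ a → spare a ≢ a
    spare-ne ev a e = <-irrefl (sym (mid-fixed (<M a) (k<M ev) mid≡a)) (toℕ<n a)
      where
      mid≡a : midℕ (toℕ a) k ≡ toℕ a
      mid≡a = trans (sym (toℕ-spare ev a)) (cong toℕ e)

    partner-spare : parity k ≡ 0ℙ → ∀ a → partner a (spare a) ≡ nothing
    partner-spare ev a = begin
      toFin? (unmid (toℕ a) (toℕ (spare a)))  ≡⟨ cong (λ c → toFin? (unmid (toℕ a) c)) (toℕ-spare ev a) ⟩
      toFin? (unmid (toℕ a) (midℕ (toℕ a) k)) ≡⟨ cong toFin? (unmid-mid (<M a) (k<M ev)) ⟩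
      toFin? k                                ≡⟨ toFin?-≥ ≤-refl ⟩
      nothing                                 ∎

    spare⁻¹-spare : parity k ≡ 0ℙ → ∀ a → spare⁻¹ (spare a) ≡ a
    spare⁻¹-spare ev a = toFinOr-toℕ (begin
      unmid k (toℕ (spare a))  ≡⟨ cong (unmid k) (trans (toℕ-spare ev a) (midℕ-comm (toℕ a) k)) ⟩
      unmid k (midℕ k (toℕ a)) ≡⟨ unmid-mid (k<M ev) (<M a) ⟩
      toℕ a                    ∎)

  two-more : ∀ {x} h → x ≡ suc (h + h) → suc (suc x) ≡ suc (suc h + suc h)
  two-more h e = cong suc (trans (cong suc e) (cong suc (sym (+-suc h h))))

  halving-shape : ∀ k → (parity k ≡ 1ℙ × k ≡ suc (⌊ k /2⌋ + ⌊ k /2⌋))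
                      ⊎ (parity k ≡ 0ℙ × suc k ≡ suc (⌊ k /2⌋ + ⌊ k /2⌋))
  halving-shape zero          = inj₂ (refl , refl)
  halving-shape (suc zero)    = inj₁ (refl , refl)
  halving-shape (suc (suc k)) with halving-shape k
  ... | inj₁ (o , e)  = inj₁ (o , two-more ⌊ k /2⌋ e)
  ... | inj₂ (ev , e) = inj₂ (ev , two-more ⌊ k /2⌋ e)

  midpoints : ∀ k → Midpoints k
  midpoints k = record
    { mid = mid ; mid-comm = mid-comm ; mid-ne = λ {a} {b} → mid-ne {a} {b}
    ; partner = partner ; partner-mid = λ {a} {b} → partner-mid {a} {b}
    ; mate = mate ; mate-mid = λ {a} {b} → mate-mid {a} {b}
    ; odd-complete = λ o {a} {b} → odd-complete o {a} {b}
    ; spare = spare ; spare⁻¹ = spare⁻¹ ; spare-ne = spare-ne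
    ; partner-spare = partner-spare ; spare⁻¹-spare = spare⁻¹-spare
    }
    where
    open FromHalving ⌊ k /2⌋ k (halving-shape k)

module Immersions where

  open import Data.Nat using (zero; suc; z<s)
  open import Data.Fin using (Fin; zero; suc; _<_)
  open import Data.Fin.Properties using (injective⇒≤; suc-injective; <-asym; <⇒≢; 0≢1+n; _≟_)
  open import Data.Product using (Σ; _×_; _,_; proj₁; proj₂)
  open import Data.Sum using (_⊎_; inj₁; inj₂)
  open import Data.List.Relation.Unary.Any using (here)
  open import Data.List.Membership.Propositional using (_∈_)
  open import Data.Empty using (⊥-elim)
  open import Relation.Nullary using (¬_; yes; no)
  open import Relation.Binary.PropositionalEquality using (_≡_; _≢_; refl; sym; trans; cong; subst₂)
  open import Function.Bundles using (_↣_; Injection)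
  open import Function.Definitions using (Injective)

  SameEdge-reflexive : ∀ {A : Set} {e : A × A} {a b} → e ≡ (a , b) → SameEdge e (a , b)
  SameEdge-reflexive eq = inj₁ (cong proj₁ eq , cong proj₂ eq)

  SameEdge-swapped : ∀ {A : Set} {e : A × A} {a b} → e ≡ (b , a) → SameEdge e (a , b)
  SameEdge-swapped eq = inj₂ (cong proj₁ eq , cong proj₂ eq)

  SameEdge-sym : ∀ {A : Set} {e f : A × A} → SameEdge e f → SameEdge f e
  SameEdge-sym (inj₁ (p , q)) = inj₁ (sym p , sym q)
  SameEdge-sym (inj₂ (p , q)) = inj₂ (sym q , sym p)

  SameEdge-trans : ∀ {A : Set} {e f g : A × A} → SameEdge e f → SameEdge f g → SameEdge e g
  SameEdge-trans (inj₁ (p , q)) (inj₁ (r , s)) = inj₁ (trans p r , trans q s)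
  SameEdge-trans (inj₁ (p , q)) (inj₂ (r , s)) = inj₂ (trans p r , trans q s)
  SameEdge-trans (inj₂ (p , q)) (inj₁ (r , s)) = inj₂ (trans p s , trans q r)
  SameEdge-trans (inj₂ (p , q)) (inj₂ (r , s)) = inj₁ (trans p s , trans q r)

  first-edge : ∀ {G x z} (w : Walk G x z) → x ≢ z → Σ (V G) λ y → Adj G x y × (x , y) ∈ edges w
  first-edge []                  x≢x = ⊥-elim (x≢x refl)
  first-edge (_∷_ {y = y} xy _) _   = y , xy , here refl

  -- Degree bound: if the neighbours of the branch vertex φ 0 are coded injectively in Fin d,
  -- then a K_{k+1}-immersion has k ≤ d, since the k paths leaving φ 0 start with distinct edges.
  immersion-≤-degree : ∀ {G k d} (I : Immersion G (suc k)) →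
    let x = Immersion.φ I zero in
    (code : ∀ y → Adj G x y → Fin d) →
    (∀ {y y'} (p : Adj G x y) (p' : Adj G x y') → code y p ≡ code y' p' → y ≡ y') → k ≤ d
  immersion-≤-degree {G} {k} {d} I code code-inj = injective⇒≤ {f = f} f-inj
    where
    open Immersion I
    start : (v : Fin k) → Σ (V G) λ y → Adj G (φ zero) y × (φ zero , y) ∈ edges (path zero (suc v) z<s)
    start v = first-edge (path zero (suc v) z<s) (λ e → 0≢1+n (φ-inj e))
    f : Fin k → Fin d
    f v = code (proj₁ (start v)) (proj₁ (proj₂ (start v)))
    f-inj : Injective _≡_ _≡_ f
    f-inj {v} {v'} eq with v ≟ v'
    ... | yes v≡v' = v≡v'
    ... | no v≢v'  = ⊥-elim (disjoint zero (suc v) z<s zero (suc v') z<s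
                       (λ (_ , 1+v≡1+v') → v≢v' (suc-injective 1+v≡1+v'))
                       (proj₂ (proj₂ (start v))) (proj₂ (proj₂ (start v')))
                       (inj₁ (refl , code-inj _ _ eq)))

  -- Ownership makes routes edge-disjoint.
  record Routing (G : Graph) (B : Set) : Set where
    field
      vertex      : B → V G
      vertex-inj  : Injective _≡_ _≡_ vertex
      route       : (a b : B) → a ≢ b → Walk G (vertex a) (vertex b)
      route-path  : ∀ a b a≢b → IsPath (route a b a≢b)
      owner       : V G × V G → V G × V G
      owner-resp  : ∀ {e f} → SameEdge e f → SameEdge (owner e) (owner f)
      route-owned : ∀ a b a≢b {e} → e ∈ edges (route a b a≢b) →
                    SameEdge (owner e) (vertex a , vertex b)

  routing⇒immersion : ∀ {G B k} → Routing G B → Fin k ↣ B → Immersion G k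
  routing⇒immersion R enum = record
    { φ        = λ u → vertex (to u)
    ; φ-inj    = λ e → injective (vertex-inj e)
    ; path     = λ u v u<v → route (to u) (to v) (distinct u<v)
    ; isPath   = λ u v u<v → route-path (to u) (to v) (distinct u<v)
    ; disjoint = disjoint
    }
    where
    open Routing R
    open Injection enum using (to; injective)

    distinct : ∀ {u v} → u < v → to u ≢ to v
    distinct u<v e = <⇒≢ u<v (injective e)

    -- Two routes sharing an edge share its owner, hence have the same ends.
    same-ends : ∀ {u v u' v'} → SameEdge (vertex (to u) , vertex (to v)) (vertex (to u') , vertex (to v')) →
                (u ≡ u' × v ≡ v') ⊎ (u ≡ v' × v ≡ u')
    same-ends (inj₁ (p , q)) = inj₁ (injective (vertex-inj p) , injective (vertex-inj q))
    same-ends (inj₂ (p , q)) = inj₂ (injective (vertex-inj p) , injective (vertex-inj q))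

    disjoint : ∀ u v (u<v : u < v) u' v' (u'<v' : u' < v') → ¬ (u ≡ u' × v ≡ v') →
               EdgeDisjoint (route (to u) (to v) (distinct u<v)) (route (to u') (to v') (distinct u'<v'))
    disjoint u v u<v u' v' u'<v' different e∈ f∈ e~f
      with same-ends (SameEdge-trans (SameEdge-sym (route-owned _ _ _ e∈))
                       (SameEdge-trans (owner-resp e~f) (route-owned _ _ _ f∈)))
    ... | inj₁ same = different same
    ... | inj₂ (u≡v' , v≡u') = <-asym u<v (subst₂ _<_ (sym v≡u') (sym u≡v') u'<v')

module ProductDegree (n m : ℕ) where

  open import Data.Nat using (suc; zero; z≤n; s≤s)
  open import Data.Nat.Properties using (+-comm)
  open import Data.Fin using (Fin; punchOut; combine)
  open import Data.Fin.Properties using (combine-injective; punchOut-injective)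
  open import Data.Product using (_,_; proj₁; proj₂)
  open import Relation.Binary.PropositionalEquality using (_≡_; cong₂; subst)
  open Immersions

  -- A neighbour differs from x in both coordinates; record the two differences.
  neighbour-code : (x : V (K (suc n) ×ᴳ K (suc m))) → ∀ y → Adj (K (suc n) ×ᴳ K (suc m)) x y → Fin (n * m)
  neighbour-code x y (a , b) = combine (punchOut a) (punchOut b)

  neighbour-code-injective : ∀ x {y y'} p p' → neighbour-code x y p ≡ neighbour-code x y' p' → y ≡ y'
  neighbour-code-injective x (a , b) (a' , b') e =
    cong₂ _,_ (punchOut-injective a a' (proj₁ same)) (punchOut-injective b b' (proj₂ same))
    where same = combine-injective _ _ _ _ e

  immersion-upper-bound : ∀ k → Immersion (K (suc n) ×ᴳ K (suc m)) k → k ≤ n * m + 1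
  immersion-upper-bound zero    _ = z≤n
  immersion-upper-bound (suc k) I = subst (suc k ≤_) (+-comm 1 (n * m))
    (s≤s (immersion-≤-degree I (neighbour-code _) (neighbour-code-injective _)))

module ProductRouting (n m : ℕ) (S₁ : MidpointSchemes.Midpoints n) (S₂ : MidpointSchemes.Midpoints m) where

  open import Data.Nat using (suc; zero; parity)
  open import Data.Parity.Base using (Parity; 0ℙ; 1ℙ)
  open import Data.Fin using (Fin; zero; suc)
  open import Data.Fin.Properties using (suc-injective; _≟_)
  open import Data.Maybe using (Maybe; just; nothing; maybe′)
  open import Data.Product using (_×_; _,_; proj₁; proj₂)
  open import Data.Sum using (_⊎_; inj₁; inj₂)
  open import Data.List.Relation.Unary.Any using (here; there)
  open import Data.List.Relation.Unary.AllPairs using ([]; _∷_)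
  open import Data.List.Relation.Unary.All using ([]; _∷_)
  open import Data.List.Membership.Propositional using (_∈_)
  open import Data.Empty using (⊥-elim)
  open import Relation.Nullary using (yes; no)
  open import Relation.Binary.PropositionalEquality using (_≡_; _≢_; refl; sym; trans; cong; cong₂)
  open MidpointSchemes using (module Midpoints; module MidpointProperties)
  open Immersions

  module M₁ = Midpoints S₁
  module M₂ = Midpoints S₂
  module P₁ = MidpointProperties S₁
  module P₂ = MidpointProperties S₂

  G : Graph
  G = K (suc n) ×ᴳ K (suc m)

  Vtx : Set
  Vtx = Fin (suc n) × Fin (suc m)

  cell : Fin n → Fin m → Vtx
  cell i j = suc i , suc j

  R : Fin n → Vtx
  R x = suc x , zero

  C : Fin m → Vtx
  C y = zero , suc y

  O : Vtx
  O = zero , zero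

  suc-≢ : ∀ {k} {a b : Fin k} → a ≢ b → Fin.suc a ≢ suc b
  suc-≢ a≢b e = a≢b (suc-injective e)

  cell-C : ∀ {i j c} → c ≢ j → Adj G (cell i j) (C c)
  cell-C c≢j = (λ ()) , suc-≢ (λ j≡c → c≢j (sym j≡c))

  cell-R : ∀ {i j x} → x ≢ i → Adj G (cell i j) (R x)
  cell-R x≢i = suc-≢ (λ i≡x → x≢i (sym i≡x)) , (λ ())

  R-C : ∀ {x y} → Adj G (R x) (C y)
  R-C = (λ ()) , (λ ())

  flip : ∀ {x y} → Adj G x y → Adj G y x
  flip = Graph.sym G

  -- Owners of the two spare edges at a cell, by the parity of the other factor: the spare
  -- C-edge serves the broken column pair when n is even and the broken row pair when n is odd.
  spareC-owner : Parity → Fin n → Fin m → Vtx × Vtx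
  spareC-owner 0ℙ i j = cell i j , cell (M₁.mate i) j
  spareC-owner 1ℙ i j = cell i j , cell i (M₂.mate j)

  spareR-owner : Parity → Fin n → Fin m → Vtx × Vtx
  spareR-owner 0ℙ i j = cell i j , cell i (M₂.mate j)
  spareR-owner 1ℙ i j = cell i j , cell (M₁.mate i) j

  row-owner : Fin n → Fin m → Maybe (Fin m) → Vtx × Vtx
  row-owner i j = maybe′ (λ j' → cell i j , cell i j') (spareC-owner (parity n) i j)

  column-owner : Fin n → Fin m → Maybe (Fin n) → Vtx × Vtx
  column-owner i j = maybe′ (λ i' → cell i j , cell i' j) (spareR-owner (parity m) i j)

  cellC-owner : Fin n → Fin m → Fin m → Vtx × Vtx
  cellC-owner i j y = row-owner i j (M₂.partner j y)

  cellR-owner : Fin n → Fin m → Fin n → Vtx × Vtx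
  cellR-owner i j x = column-owner i j (M₁.partner i x)

  -- Owner of an R–C edge (arguments: parities of m and n): when exactly one factor is even,
  -- these edges are the middle of the long detours of that factor's broken pairs.
  RC-owner : Parity → Parity → Fin n → Fin m → Vtx × Vtx
  RC-owner 0ℙ 1ℙ x y = cell x (M₂.spare⁻¹ y) , cell x (M₂.mate (M₂.spare⁻¹ y))
  RC-owner 1ℙ 0ℙ x y = cell (M₁.spare⁻¹ x) y , cell (M₁.mate (M₁.spare⁻¹ x)) y
  RC-owner _  _  x y = R x , C y

  owner : Vtx × Vtx → Vtx × Vtx
  owner ((suc i , suc j) , (zero , suc y))  = cellC-owner i j y
  owner ((zero , suc y)  , (suc i , suc j)) = cellC-owner i j y
  owner ((suc i , suc j) , (suc x , zero))  = cellR-owner i j x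
  owner ((suc x , zero)  , (suc i , suc j)) = cellR-owner i j x
  owner ((suc x , zero)  , (zero , suc y))  = RC-owner (parity m) (parity n) x y
  owner ((zero , suc y)  , (suc x , zero))  = RC-owner (parity m) (parity n) x y
  owner e                                   = e

  owner-flip : ∀ a b → SameEdge (owner (a , b)) (owner (b , a))
  owner-flip (zero , zero)   (zero , zero)   = inj₁ (refl , refl)
  owner-flip (zero , zero)   (zero , suc _)  = inj₂ (refl , refl)
  owner-flip (zero , zero)   (suc _ , zero)  = inj₂ (refl , refl)
  owner-flip (zero , zero)   (suc _ , suc _) = inj₂ (refl , refl)
  owner-flip (zero , suc _)  (zero , zero)   = inj₂ (refl , refl)
  owner-flip (zero , suc _)  (zero , suc _)  = inj₂ (refl , refl)
  owner-flip (zero , suc _)  (suc _ , zero)  = inj₁ (refl , refl)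
  owner-flip (zero , suc _)  (suc _ , suc _) = inj₁ (refl , refl)
  owner-flip (suc _ , zero)  (zero , zero)   = inj₂ (refl , refl)
  owner-flip (suc _ , zero)  (zero , suc _)  = inj₁ (refl , refl)
  owner-flip (suc _ , zero)  (suc _ , zero)  = inj₂ (refl , refl)
  owner-flip (suc _ , zero)  (suc _ , suc _) = inj₁ (refl , refl)
  owner-flip (suc _ , suc _) (zero , zero)   = inj₂ (refl , refl)
  owner-flip (suc _ , suc _) (zero , suc _)  = inj₁ (refl , refl)
  owner-flip (suc _ , suc _) (suc _ , zero)  = inj₁ (refl , refl)
  owner-flip (suc _ , suc _) (suc _ , suc _) = inj₂ (refl , refl)

  owner-resp : ∀ {e f} → SameEdge e f → SameEdge (owner e) (owner f)
  owner-resp (inj₁ (refl , refl))               = inj₁ (refl , refl)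
  owner-resp {a , b} (inj₂ (refl , refl)) = owner-flip a b

  cellC-mid : ∀ {i j j' y} → M₂.mid j j' ≡ just y → cellC-owner i j y ≡ (cell i j , cell i j')
  cellC-mid {i} {j} e = cong (row-owner i j) (M₂.partner-mid e)

  cellR-mid : ∀ {i i' j x} → M₁.mid i i' ≡ just x → cellR-owner i j x ≡ (cell i j , cell i' j)
  cellR-mid {i} {_} {j} e = cong (column-owner i j) (M₁.partner-mid e)

  cellC-spare : ∀ {i j} → parity m ≡ 0ℙ → cellC-owner i j (M₂.spare j) ≡ spareC-owner (parity n) i j
  cellC-spare {i} {j} ev = cong (row-owner i j) (M₂.partner-spare ev j)

  cellR-spare : ∀ {i j} → parity n ≡ 0ℙ → cellR-owner i j (M₁.spare i) ≡ spareR-owner (parity m) i j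
  cellR-spare {i} {j} ev = cong (column-owner i j) (M₁.partner-spare ev i)

  record OwnedPath (x y : Vtx) : Set where
    constructor owned-path
    field
      walk  : Walk G x y
      path  : IsPath walk
      owned : ∀ {e} → e ∈ edges walk → SameEdge (owner e) (x , y)

  direct : ∀ {x y} → Adj G x y → owner (x , y) ≡ (x , y) → OwnedPath x y
  direct xy eq = owned-path (xy ∷ [])
    (((λ { refl → Graph.irrefl G xy }) ∷ []) ∷ [] ∷ [])
    λ { (here refl) → SameEdge-reflexive eq ; (there ()) }

  -- Cells i j and i j' of a common row are joined through C (mid j j'); a broken pair uses the
  -- spare R-edges when n is even, and the detour through C (spare j), R i, C (spare j') when n is odd.
  module RowRoute (i : Fin n) {j j' : Fin m} (j≢j' : j ≢ j') where

    cells-differ : cell i j ≢ cell i j'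
    cells-differ e = j≢j' (suc-injective (cong proj₂ e))

    via-mid : ∀ {c} → M₂.mid j j' ≡ just c → OwnedPath (cell i j) (cell i j')
    via-mid e = owned-path
      (cell-C (M₂.mid-ne j≢j' e) ∷ flip (cell-C (P₂.mid-ne′ j≢j' e)) ∷ [])
      (((λ ()) ∷ cells-differ ∷ []) ∷ ((λ ()) ∷ []) ∷ [] ∷ [])
      λ { (here refl)         → SameEdge-reflexive (cellC-mid e)
        ; (there (here refl)) → SameEdge-swapped (cellC-mid (trans (M₂.mid-comm j' j) e))
        ; (there (there ())) }

    via-spare-R : parity n ≡ 0ℙ → M₂.mid j j' ≡ nothing → OwnedPath (cell i j) (cell i j')
    via-spare-R ev e = owned-path
      (cell-R (M₁.spare-ne ev i) ∷ flip (cell-R (M₁.spare-ne ev i)) ∷ [])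
      (((λ ()) ∷ cells-differ ∷ []) ∷ ((λ ()) ∷ []) ∷ [] ∷ [])
      λ { (here refl)         → SameEdge-reflexive (spare-owner e)
        ; (there (here refl)) → SameEdge-swapped (spare-owner (trans (M₂.mid-comm j' j) e))
        ; (there (there ())) }
      where
      spare-owner : ∀ {a b} → M₂.mid a b ≡ nothing → cellR-owner i a (M₁.spare i) ≡ (cell i a , cell i b)
      spare-owner {a} e = trans (cellR-spare ev)
        (trans (cong (λ p → spareR-owner p i a) (P₂.broken⇒even e))
               (cong (λ b → cell i a , cell i b) (M₂.mate-mid e)))

    via-detour : parity n ≡ 1ℙ → M₂.mid j j' ≡ nothing → OwnedPath (cell i j) (cell i j')
    via-detour od e = owned-path
      (cell-C (M₂.spare-ne ev j) ∷ flip (R-C {i}) ∷ R-C ∷ flip (cell-C (M₂.spare-ne ev j')) ∷ [])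
      (  ((λ ()) ∷ (λ ()) ∷ (λ ()) ∷ cells-differ ∷ [])
       ∷ ((λ ()) ∷ (λ s → j≢j' (P₂.spare-injective ev (suc-injective (cong proj₂ s)))) ∷ (λ ()) ∷ [])
       ∷ ((λ ()) ∷ (λ ()) ∷ [])
       ∷ ((λ ()) ∷ [])
       ∷ [] ∷ [])
      λ { (here refl)                       → SameEdge-reflexive (spare-owner e)
        ; (there (here refl))               → SameEdge-reflexive (axis-owner e)
        ; (there (there (here refl)))       → SameEdge-swapped (axis-owner e')
        ; (there (there (there (here refl)))) → SameEdge-swapped (spare-owner e')
        ; (there (there (there (there ())))) }
      where
      ev = P₂.broken⇒even e
      e' = trans (M₂.mid-comm j' j) e
      spare-owner : ∀ {a b} → M₂.mid a b ≡ nothing → cellC-owner i a (M₂.spare a) ≡ (cell i a , cell i b)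
      spare-owner {a} e = trans (cellC-spare ev)
        (trans (cong (λ p → spareC-owner p i a) od) (cong (λ b → cell i a , cell i b) (M₂.mate-mid e)))
      axis-owner : ∀ {a b} → M₂.mid a b ≡ nothing →
                   RC-owner (parity m) (parity n) i (M₂.spare a) ≡ (cell i a , cell i b)
      axis-owner {a} e = trans (cong₂ (λ p q → RC-owner p q i (M₂.spare a)) ev od)
        (trans (cong (λ a' → cell i a' , cell i (M₂.mate a')) (M₂.spare⁻¹-spare ev a))
               (cong (λ b → cell i a , cell i b) (M₂.mate-mid e)))

    row-route : OwnedPath (cell i j) (cell i j')
    row-route with M₂.mid j j' in e | parity n in p
    ... | just c  | _  = via-mid e
    ... | nothing | 0ℙ = via-spare-R p e
    ... | nothing | 1ℙ = via-detour p e

  module ColumnRoute {i i' : Fin n} (j : Fin m) (i≢i' : i ≢ i') where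

    cells-differ : cell i j ≢ cell i' j
    cells-differ e = i≢i' (suc-injective (cong proj₁ e))

    via-mid : ∀ {c} → M₁.mid i i' ≡ just c → OwnedPath (cell i j) (cell i' j)
    via-mid e = owned-path
      (cell-R (M₁.mid-ne i≢i' e) ∷ flip (cell-R (P₁.mid-ne′ i≢i' e)) ∷ [])
      (((λ ()) ∷ cells-differ ∷ []) ∷ ((λ ()) ∷ []) ∷ [] ∷ [])
      λ { (here refl)         → SameEdge-reflexive (cellR-mid e)
        ; (there (here refl)) → SameEdge-swapped (cellR-mid (trans (M₁.mid-comm i' i) e))
        ; (there (there ())) }

    via-spare-C : parity m ≡ 0ℙ → M₁.mid i i' ≡ nothing → OwnedPath (cell i j) (cell i' j)
    via-spare-C ev e = owned-path
      (cell-C (M₂.spare-ne ev j) ∷ flip (cell-C (M₂.spare-ne ev j)) ∷ [])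
      (((λ ()) ∷ cells-differ ∷ []) ∷ ((λ ()) ∷ []) ∷ [] ∷ [])
      λ { (here refl)         → SameEdge-reflexive (spare-owner e)
        ; (there (here refl)) → SameEdge-swapped (spare-owner (trans (M₁.mid-comm i' i) e))
        ; (there (there ())) }
      where
      spare-owner : ∀ {a b} → M₁.mid a b ≡ nothing → cellC-owner a j (M₂.spare j) ≡ (cell a j , cell b j)
      spare-owner {a} e = trans (cellC-spare ev)
        (trans (cong (λ p → spareC-owner p a j) (P₁.broken⇒even e))
               (cong (λ b → cell a j , cell b j) (M₁.mate-mid e)))

    via-detour : parity m ≡ 1ℙ → M₁.mid i i' ≡ nothing → OwnedPath (cell i j) (cell i' j)
    via-detour od e = owned-path
      (cell-R (M₁.spare-ne ev i) ∷ R-C ∷ flip R-C ∷ flip (cell-R (M₁.spare-ne ev i')) ∷ [])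
      (  ((λ ()) ∷ (λ ()) ∷ (λ ()) ∷ cells-differ ∷ [])
       ∷ ((λ ()) ∷ (λ s → i≢i' (P₁.spare-injective ev (suc-injective (cong proj₁ s)))) ∷ (λ ()) ∷ [])
       ∷ ((λ ()) ∷ (λ ()) ∷ [])
       ∷ ((λ ()) ∷ [])
       ∷ [] ∷ [])
      λ { (here refl)                       → SameEdge-reflexive (spare-owner e)
        ; (there (here refl))               → SameEdge-reflexive (axis-owner e)
        ; (there (there (here refl)))       → SameEdge-swapped (axis-owner e')
        ; (there (there (there (here refl)))) → SameEdge-swapped (spare-owner e')
        ; (there (there (there (there ())))) }
      where
      ev = P₁.broken⇒even e
      e' = trans (M₁.mid-comm i' i) e
      spare-owner : ∀ {a b} → M₁.mid a b ≡ nothing → cellR-owner a j (M₁.spare a) ≡ (cell a j , cell b j)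
      spare-owner {a} e = trans (cellR-spare ev)
        (trans (cong (λ p → spareR-owner p a j) od) (cong (λ b → cell a j , cell b j) (M₁.mate-mid e)))
      axis-owner : ∀ {a b} → M₁.mid a b ≡ nothing →
                   RC-owner (parity m) (parity n) (M₁.spare a) j ≡ (cell a j , cell b j)
      axis-owner {a} e = trans (cong₂ (λ p q → RC-owner p q (M₁.spare a) j) od ev)
        (trans (cong (λ a' → cell a' j , cell (M₁.mate a') j) (M₁.spare⁻¹-spare ev a))
               (cong (λ b → cell a j , cell b j) (M₁.mate-mid e)))

    column-route : OwnedPath (cell i j) (cell i' j)
    column-route with M₁.mid i i' in e | parity m in p
    ... | just c  | _  = via-mid e
    ... | nothing | 0ℙ = via-spare-C p e
    ... | nothing | 1ℙ = via-detour p e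

  Branch : Set
  Branch = (Fin n × Fin m) ⊎ Fin 1

  branch-vertex : Branch → Vtx
  branch-vertex (inj₁ (i , j)) = cell i j
  branch-vertex (inj₂ zero)    = O

  branch-vertex-injective : ∀ {a b} → branch-vertex a ≡ branch-vertex b → a ≡ b
  branch-vertex-injective {inj₁ _}    {inj₁ _}    e  =
    cong inj₁ (cong₂ _,_ (suc-injective (cong proj₁ e)) (suc-injective (cong proj₂ e)))
  branch-vertex-injective {inj₁ _}    {inj₂ zero} ()
  branch-vertex-injective {inj₂ zero} {inj₁ _}    ()
  branch-vertex-injective {inj₂ zero} {inj₂ zero} refl = refl

  -- Distinct cells share a row, share a column, or are adjacent.
  cell-route : ∀ i j i' j' → cell i j ≢ cell i' j' → OwnedPath (cell i j) (cell i' j')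
  cell-route i j i' j' differ with i ≟ i' | j ≟ j'
  ... | yes refl | yes refl = ⊥-elim (differ refl)
  ... | yes refl | no j≢j'  = RowRoute.row-route i j≢j'
  ... | no i≢i'  | yes refl = ColumnRoute.column-route j i≢i'
  ... | no i≢i'  | no j≢j'  = direct (suc-≢ i≢i' , suc-≢ j≢j') refl

  branch-route : (a b : Branch) → a ≢ b → OwnedPath (branch-vertex a) (branch-vertex b)
  branch-route (inj₂ zero)    (inj₂ zero)      a≢b = ⊥-elim (a≢b refl)
  branch-route (inj₂ zero)    (inj₁ (i , j))   _   = direct ((λ ()) , (λ ())) refl
  branch-route (inj₁ (i , j)) (inj₂ zero)      _   = direct ((λ ()) , (λ ())) refl
  branch-route (inj₁ (i , j)) (inj₁ (i' , j')) a≢b =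
    cell-route i j i' j' (λ e → a≢b (branch-vertex-injective e))

  routing : Routing G Branch
  routing = record
    { vertex      = branch-vertex
    ; vertex-inj  = branch-vertex-injective
    ; route       = λ a b a≢b → OwnedPath.walk (branch-route a b a≢b)
    ; route-path  = λ a b a≢b → OwnedPath.path (branch-route a b a≢b)
    ; owner       = owner
    ; owner-resp  = owner-resp
    ; route-owned = λ a b a≢b → OwnedPath.owned (branch-route a b a≢b)
    }

open import Data.Nat using (suc)
open import Data.Fin using (Fin)
open import Data.Fin.Properties using (+↔⊎; *↔×)
open import Data.Product using (_×_; _,_)
open import Data.Sum using (_⊎_)
open import Data.Sum.Function.Propositional using (_⊎-↔_)
open import Function.Bundles using (_↣_)
open import Function.Properties.Inverse using (↔-refl; ↔-trans; ↔⇒↣)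

enumerate-branches : ∀ n m → Fin (n * m + 1) ↣ ((Fin n × Fin m) ⊎ Fin 1)
enumerate-branches n m = ↔⇒↣ (↔-trans +↔⊎ (*↔× ⊎-↔ ↔-refl))

theorem20 : (t r : ℕ) → 1 ≤ t → 1 ≤ r →
    IsImmersionNumber (K t ×ᴳ K r) ((t ∸ 1) * (r ∸ 1) + 1)
theorem20 (suc n) (suc m) _ _ = lower-bound , upper-bound
  where
  open MidpointSchemes using (midpoints)

  lower-bound : Immersion (K (suc n) ×ᴳ K (suc m)) (n * m + 1)
  lower-bound = Immersions.routing⇒immersion
    (ProductRouting.routing n m (midpoints n) (midpoints m)) (enumerate-branches n m)

  upper-bound : ∀ k → Immersion (K (suc n) ×ᴳ K (suc m)) k → k ≤ n * m + 1
  upper-bound = ProductDegree.immersion-upper-bound n m
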